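{- For $m \geq 3$ and $n \geq 6$, writing $n=3k$, $3k+1$ or $3k+2$ with $k$ a positive integer, $$\gamma(C_n\times K_m)= \begin{cases} 2k, & n=3k;\\ 2k+1, & n=3k+1;\\ 2k+2, & n=3k+2.\end{cases}$$
   Context: $C_n$ is the cycle on $\{1,\dots,n\}$ with edges $\{i,i+1\}$ and $\{n,1\}$; $K_m$ is the complete graph on $\{1,\dots,m\}$. The direct product $G\times H$ has vertex set $V(G)\times V(H)$ with $(g_1,h_1)\sim(g_2,h_2)$ iff $g_1g_2\in E(G)$ and $h_1h_2\in E(H)$. $\gamma(G)$ denotes the domination number: the minimum size of a set $D$ of vertices such that every vertex not in $D$ is adjacent to a vertex of $D$. -}

module Defs where

open import Data.Nat using (ℕ; zero; suc; _+_; _*_; _≤_; _<_)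
open import Data.Nat.DivMod using (_/_; _%_)
open import Data.Fin using (Fin; toℕ)
open import Data.Product using (_×_; _,_; Σ; ∃-syntax)
open import Data.Sum using (_⊎_)
open import Data.List using (List; length)
open import Data.List.Membership.Propositional using (_∈_)
open import Data.List.Relation.Unary.Unique.Propositional using (Unique)
open import Relation.Binary.PropositionalEquality using (_≡_; _≢_)

record Graph : Set₁ where
  field
    V   : Set
    Adj : V → V → Set
open Graph public

-- Cycle C_n: vertices 1..n are represented by Fin n (vertex i+1 ↦ i);
-- edges {i,i+1} and {n,1}, i.e. i ~ j iff j ≡ i+1 (mod n) or i ≡ j+1 (mod n).
CycleAdj : (n : ℕ) → Fin n → Fin n → Set
CycleAdj n i j = (suc (toℕ i) ≡ toℕ j) ⊎ (suc (toℕ j) ≡ toℕ i)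
               ⊎ ((suc (toℕ i) ≡ n) × (toℕ j ≡ 0))
               ⊎ ((suc (toℕ j) ≡ n) × (toℕ i ≡ 0))

C : ℕ → Graph
C n = record { V = Fin n ; Adj = CycleAdj n }

K : ℕ → Graph
K m = record { V = Fin m ; Adj = λ i j → i ≢ j }

_×ᵍ_ : Graph → Graph → Graph
G ×ᵍ H = record
  { V   = V G × V H
  ; Adj = λ { (g₁ , h₁) (g₂ , h₂) → Adj G g₁ g₂ × Adj H h₁ h₂ } }

Dominating : (G : Graph) → List (V G) → Set
Dominating G D = ∀ v → v ∈ D ⊎ (∃[ u ] (u ∈ D × Adj G u v))

DominationNumber : Graph → ℕ → Set
DominationNumber G d =
  (∃[ D ] (Unique D × Dominating G D × length D ≡ d))
  × (∀ D → Dominating G D → d ≤ length D)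

-- Lower bound: the vertices (c , a) of a column c of Cₙ × Kₘ are dominated only from the
-- columns c - 1, c, c + 1, and one vertex of D can never dominate the whole column c, so
-- every window of three consecutive columns contains at least two vertices of D. Summing
-- over the n cyclic windows counts each vertex of D three times: 3 |D| ≥ 2n.
--
-- Upper bound: write n = 3k + e and cut the columns into blocks {3i, 3i+1, 3i+2}. Take the
-- columns j with j % 3 < 2, and in each the vertex whose colour is χ(j / 3 % k) for a proper
-- 3-colouring χ of the cycle C_k. A selected column is dominated together with its twin of
-- the same block (for e = 1 the lone column 3k is the twin of column 0, as k % k = 0), and
-- a column 3i + 2 by its two neighbours, whose colours χ(i % k), χ(suc i % k) differ. This
-- uses 2k + e = ⌈2n/3⌉ vertices.
module Submission where

open import Defs
open import Data.Nat using (ℕ; _≤_; _+_; _*_)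
open import Data.Product using (_×_)
open import Relation.Binary.PropositionalEquality using (_≡_)

open import Data.Bool.Base using (true; false)
open import Data.Empty using (⊥-elim)
open import Data.Fin as Fin using (Fin; toℕ; fromℕ<)
open import Data.Fin.Properties using (toℕ-fromℕ<; toℕ<n; fromℕ<-cong)
open import Data.List.Base using (List; []; _∷_; length; map; filter; upTo; applyUpTo; allFin; tabulate)
open import Data.List.Membership.Propositional using (_∈_)
open import Data.List.Membership.Propositional.Properties using (∈-length; ∈-filter⁺; ∈-allFin; ∈-map⁺)
open import Data.List.Properties
  using (length-map; map-tabulate; map-upTo; filter-≐; filter-accept; filter-reject)
open import Data.List.Relation.Unary.Any using (here; there)
open import Data.List.Relation.Unary.Unique.Propositional using (Unique)
import Data.List.Relation.Unary.Unique.Propositional.Properties as Unique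
open import Data.Nat.Base
  using (zero; suc; _<_; z<s; s<s; _%_; _/_; z≤n; s≤s; s≤s⁻¹; NonZero; >-nonZero; >-nonZero⁻¹)
open import Data.Nat.Divisibility using (n∣m*n)
open import Data.Nat.DivMod
open import Data.Nat.Properties
open import Algebra.Properties.CommutativeSemigroup +-commutativeSemigroup
  using () renaming (interchange to +-interchange)
open import Data.Nat.Tactic.RingSolver using (solve-∀)
open import Data.Product using (Σ; ∃-syntax; _,_; proj₁; proj₂)
open import Data.Sum using (_⊎_; inj₁; inj₂)
open import Function.Base using (_∘_)
open import Level using (0ℓ)
open import Relation.Binary.PropositionalEquality
  using (_≢_; refl; sym; trans; cong; cong₂; subst; module ≡-Reasoning)
open import Relation.Nullary using (¬_; yes; no; does)
open import Relation.Nullary.Decidable using (_⊎-dec_)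
open import Relation.Unary using (Pred; Decidable; _≐_)

count : {A : Set} {P : Pred A 0ℓ} → Decidable P → List A → ℕ
count P? = length ∘ filter P?

module _ {A : Set} where

  distinct-∈⇒2≤length : ∀ {x y : A} {xs} → x ∈ xs → y ∈ xs → x ≢ y → 2 ≤ length xs
  distinct-∈⇒2≤length (here refl) (here refl) x≢y = ⊥-elim (x≢y refl)
  distinct-∈⇒2≤length (here _)    (there y∈)  _   = s≤s (∈-length y∈)
  distinct-∈⇒2≤length (there x∈)  (here _)    _   = s≤s (∈-length x∈)
  distinct-∈⇒2≤length (there x∈)  (there y∈)  x≢y = m≤n⇒m≤1+n (distinct-∈⇒2≤length x∈ y∈ x≢y)

  module _ {P : Pred A 0ℓ} (P? : Decidable P) where

    2≤count : ∀ {x y xs} → x ∈ xs → y ∈ xs → x ≢ y → P x → P y → 2 ≤ count P? xs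
    2≤count x∈ y∈ x≢y px py = distinct-∈⇒2≤length (∈-filter⁺ P? x∈ px) (∈-filter⁺ P? y∈ py) x≢y

    count-accept : ∀ {x} xs → P x → count P? (x ∷ xs) ≡ suc (count P? xs)
    count-accept xs px = cong length (filter-accept P? px)

    count-reject : ∀ {x} xs → ¬ P x → count P? (x ∷ xs) ≡ count P? xs
    count-reject xs ¬px = cong length (filter-reject P? ¬px)

    count-⊎ : {Q : Pred A 0ℓ} (Q? : Decidable Q) → ∀ xs →
              count (λ x → P? x ⊎-dec Q? x) xs ≤ count P? xs + count Q? xs
    count-⊎ Q? [] = z≤n
    count-⊎ Q? (x ∷ xs) with P? x | Q? x
    ... | yes _ | yes _ = s≤s (≤-trans (count-⊎ Q? xs) (+-monoʳ-≤ _ (n≤1+n _)))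
    ... | yes _ | no _  = s≤s (count-⊎ Q? xs)
    ... | no _  | yes _ = ≤-trans (s≤s (count-⊎ Q? xs)) (≤-reflexive (sym (+-suc _ _)))
    ... | no _  | no _  = count-⊎ Q? xs

    count-map : {B : Set} (f : B → A) → ∀ xs → count P? (map f xs) ≡ count (P? ∘ f) xs
    count-map f [] = refl
    count-map f (x ∷ xs) with does (P? (f x))
    ... | true  = cong suc (count-map f xs)
    ... | false = count-map f xs

∑< : ℕ → (ℕ → ℕ) → ℕ
∑< zero    f = 0
∑< (suc N) f = ∑< N f + f N

syntax ∑< N (λ j → t) = ∑[ j < N ] t

∑-zero : ∀ N → ∑[ j < N ] 0 ≡ 0
∑-zero zero    = refl
∑-zero (suc N) = trans (+-identityʳ _) (∑-zero N)

∑-cong : ∀ N {f g : ℕ → ℕ} → (∀ {j} → j < N → f j ≡ g j) → ∑< N f ≡ ∑< N g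
∑-cong zero    f≗g = refl
∑-cong (suc N) f≗g = cong₂ _+_ (∑-cong N (f≗g ∘ m<n⇒m<1+n)) (f≗g ≤-refl)

∑-+ : ∀ N (f g : ℕ → ℕ) → ∑[ j < N ] (f j + g j) ≡ ∑< N f + ∑< N g
∑-+ zero    f g = refl
∑-+ (suc N) f g =
  trans (cong (_+ (f N + g N)) (∑-+ N f g)) (+-interchange (∑< N f) (∑< N g) (f N) (g N))

N*c≤∑ : ∀ N {c} (f : ℕ → ℕ) → (∀ j → c ≤ f j) → N * c ≤ ∑< N f
N*c≤∑ zero    f c≤f = z≤n
N*c≤∑ (suc N) f c≤f = ≤-trans (≤-reflexive (+-comm _ (N * _))) (+-mono-≤ (N*c≤∑ N f c≤f) (c≤f N))

∑-head : ∀ N (f : ℕ → ℕ) → ∑< (suc N) f ≡ f 0 + ∑[ j < N ] f (suc j)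
∑-head zero    f = +-comm 0 (f 0)
∑-head (suc N) f = trans (cong (_+ f (suc N)) (∑-head N f)) (+-assoc (f 0) _ _)

∑-rotate : ∀ N (f : ℕ → ℕ) → f N ≡ f 0 → ∑[ j < N ] f (suc j) ≡ ∑< N f
∑-rotate N f fN≡f0 = +-cancelˡ-≡ (f 0) _ _ (begin
  f 0 + ∑[ j < N ] f (suc j)  ≡⟨ ∑-head N f ⟨
  ∑< N f + f N                ≡⟨ cong (∑< N f +_) fN≡f0 ⟩
  ∑< N f + f 0                ≡⟨ +-comm (∑< N f) (f 0) ⟩
  f 0 + ∑< N f                ∎)
  where open ≡-Reasoning

∑-bump : ∀ N {c} {f g : ℕ → ℕ} → c < N → (∀ {j} → j < N → j ≢ c → f j ≡ g j) →
         f c ≡ suc (g c) → ∑< N f ≡ suc (∑< N g)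
∑-bump (suc N) {c} c<1+N f≗g fc≡1+gc with c ≟ N
... | yes refl =
  trans (cong₂ _+_ (∑-cong N (λ j<c → f≗g (m<n⇒m<1+n j<c) (<⇒≢ j<c))) fc≡1+gc) (+-suc _ _)
... | no c≢N =
  cong₂ _+_ (∑-bump N (≤∧≢⇒< (s≤s⁻¹ c<1+N) c≢N) (f≗g ∘ m<n⇒m<1+n) fc≡1+gc) (f≗g ≤-refl (c≢N ∘ sym))

module _ {d : ℕ} .{{_ : NonZero d}} where

  [r+i*d]%d≡r : ∀ {r} i → r < d → (r + i * d) % d ≡ r
  [r+i*d]%d≡r {r} i r<d = trans ([m+kn]%n≡m%n r i d) (m<n⇒m%n≡m r<d)

  [r+i*d]/d≡i : ∀ {r} i → r < d → (r + i * d) / d ≡ i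
  [r+i*d]/d≡i {r} i r<d = begin
    (r + i * d) / d    ≡⟨ +-distrib-/-∣ʳ r (n∣m*n i) ⟩
    r / d + i * d / d  ≡⟨ cong₂ _+_ (m<n⇒m/n≡0 r<d) (m*n/n≡m i d) ⟩
    i                  ∎
    where open ≡-Reasoning

  [1+m]%d-cases : ∀ {m} → m < d → suc m % d ≡ suc m ⊎ (suc m ≡ d × suc m % d ≡ 0)
  [1+m]%d-cases m<d with m≤n⇒m<n∨m≡n m<d
  ... | inj₁ 1+m<d = inj₁ (m<n⇒m%n≡m 1+m<d)
  ... | inj₂ refl  = inj₂ (refl , n%n≡0 d)

  [1+m%d]%d≡[1+m]%d : ∀ m → suc (m % d) % d ≡ suc m % d
  [1+m%d]%d≡[1+m]%d m = begin
    suc (m % d) % d              ≡⟨ [m+kn]%n≡m%n (suc (m % d)) (m / d) d ⟨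
    suc (m % d + m / d * d) % d  ≡⟨ cong (λ x → suc x % d) (m≡m%n+[m/n]*n m d) ⟨
    suc m % d                    ∎
    where open ≡-Reasoning

  [1+m]%d-injective : ∀ {a b} → a < d → b < d → suc a % d ≡ suc b % d → a ≡ b
  [1+m]%d-injective a<d b<d eq with [1+m]%d-cases a<d | [1+m]%d-cases b<d
  ... | inj₁ ea       | inj₁ eb       = suc-injective (trans (sym ea) (trans eq eb))
  ... | inj₁ ea       | inj₂ (_ , eb) = ⊥-elim (1+n≢0 (trans (sym ea) (trans eq eb)))
  ... | inj₂ (_ , ea) | inj₁ eb       = ⊥-elim (1+n≢0 (trans (sym eb) (trans (sym eq) ea)))
  ... | inj₂ (ea , _) | inj₂ (eb , _) = suc-injective (trans ea (sym eb))

module Cycle {n : ℕ} .{{_ : NonZero n}} where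

  adjacent⇒successor : ∀ {p q} → CycleAdj n p q →
                       toℕ q ≡ suc (toℕ p) % n ⊎ toℕ p ≡ suc (toℕ q) % n
  adjacent⇒successor {p} {q} (inj₁ e) =
    inj₁ (trans (sym e) (sym (m<n⇒m%n≡m (subst (_< n) (sym e) (toℕ<n q)))))
  adjacent⇒successor {p} {q} (inj₂ (inj₁ e)) =
    inj₂ (trans (sym e) (sym (m<n⇒m%n≡m (subst (_< n) (sym e) (toℕ<n p)))))
  adjacent⇒successor (inj₂ (inj₂ (inj₁ (e , q≡0)))) =
    inj₁ (trans q≡0 (sym (trans (cong (_% n) e) (n%n≡0 n))))
  adjacent⇒successor (inj₂ (inj₂ (inj₂ (e , p≡0)))) =
    inj₂ (trans p≡0 (sym (trans (cong (_% n) e) (n%n≡0 n))))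

  successor⇒adjacent : ∀ {p q} → toℕ q ≡ suc (toℕ p) % n → CycleAdj n q p
  successor⇒adjacent {p} q≡ with [1+m]%d-cases (toℕ<n p)
  ... | inj₁ e        = inj₂ (inj₁ (sym (trans q≡ e)))
  ... | inj₂ (e , e′) = inj₂ (inj₂ (inj₂ (e , trans q≡ e′)))

  loopless : 2 ≤ n → ∀ g → ¬ CycleAdj n g g
  loopless 2≤n g (inj₁ e)                        = 1+n≢n e
  loopless 2≤n g (inj₂ (inj₁ e))                 = 1+n≢n e
  loopless 2≤n g (inj₂ (inj₂ (inj₁ (e , g≡0)))) = <-irrefl (trans (cong suc (sym g≡0)) e) 2≤n
  loopless 2≤n g (inj₂ (inj₂ (inj₂ (e , g≡0)))) = <-irrefl (trans (cong suc (sym g≡0)) e) 2≤n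

  neighbours-of-successor : ∀ {u} j → CycleAdj n u (suc j mod n) →
                            toℕ u ≡ j % n ⊎ toℕ u ≡ suc (suc j) % n
  neighbours-of-successor {u} j adj with adjacent⇒successor adj
  ... | inj₁ e = inj₁ ([1+m]%d-injective (toℕ<n u) (m%n<n j n) (begin
      suc (toℕ u) % n    ≡⟨ e ⟨
      toℕ (suc j mod n)  ≡⟨ toℕ-fromℕ< _ ⟩
      suc j % n          ≡⟨ [1+m%d]%d≡[1+m]%d j ⟨
      suc (j % n) % n    ∎))
    where open ≡-Reasoning
  ... | inj₂ e =
    inj₂ (trans e (trans (cong (λ x → suc x % n) (toℕ-fromℕ< _)) ([1+m%d]%d≡[1+m]%d (suc j))))

  successor : Fin n → Fin n
  successor c = suc (toℕ c) mod n

  successor-adjacent : ∀ c → CycleAdj n (successor c) c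
  successor-adjacent c = successor⇒adjacent (toℕ-fromℕ< _)

  successor-cases : ∀ c → toℕ (successor c) ≡ suc (toℕ c)
                        ⊎ (suc (toℕ c) ≡ n × toℕ (successor c) ≡ 0)
  successor-cases c with [1+m]%d-cases (toℕ<n c)
  ... | inj₁ e          = inj₁ (trans (toℕ-fromℕ< _) e)
  ... | inj₂ (wrap , e) = inj₂ (wrap , trans (toℕ-fromℕ< _) e)

  predecessor : ∀ {c t} → toℕ c ≡ suc t → Σ (Fin n) λ p → toℕ p ≡ t × CycleAdj n p c
  predecessor {c} c≡ =
    fromℕ< t<n , toℕ-fromℕ< t<n , inj₁ (trans (cong suc (toℕ-fromℕ< t<n)) (sym c≡))
    where t<n = <⇒≤ (subst (_< n) c≡ (toℕ<n c))

module _ {G : Graph} (loopless : ∀ g → ¬ Adj G g g) where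

  neighbour-≢ : ∀ {m p c} {a b : Fin m} → Adj G p c → (p , a) ≢ (c , b)
  neighbour-≢ p~c e = loopless _ (subst (λ g → Adj G g _) (cong proj₁ e) p~c)

  -- If (c , 0) has a dominator (p , b) outside column c, the second one is a dominator
  -- of (c , b).
  two-dominators : ∀ {m} → 2 ≤ m → ∀ {D} → Dominating (G ×ᵍ K m) D →
                   ∀ {P : Pred (V G) 0ℓ} (P? : Decidable P) {c} → P c → (∀ {g} → Adj G g c → P g) →
                   2 ≤ count (P? ∘ proj₁) D
  two-dominators (s≤s (s≤s z≤n)) dom P? {c} Pc near with dom (c , Fin.zero)
  ... | inj₁ c0∈D with dom (c , Fin.suc Fin.zero)
  ...   | inj₁ c1∈D = 2≤count _ c0∈D c1∈D (λ ()) Pc Pc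
  ...   | inj₂ ((q , _) , qb∈D , q~c , _) =
          2≤count _ c0∈D qb∈D (neighbour-≢ q~c ∘ sym) Pc (near q~c)
  two-dominators (s≤s (s≤s z≤n)) dom P? {c} Pc near | inj₂ ((p , b) , pb∈D , p~c , _)
    with dom (c , b)
  ...   | inj₁ cb∈D = 2≤count _ pb∈D cb∈D (neighbour-≢ p~c) (near p~c) Pc
  ...   | inj₂ ((q , _) , qb′∈D , q~c , b′≢b) =
          2≤count _ pb∈D qb′∈D (λ e → b′≢b (sym (cong proj₂ e))) (near p~c) (near q~c)

module LabelledColumns {G : Graph} {m : ℕ} (S : List (V G)) (label : V G → Fin m) where

  graph : List (V G × Fin m)
  graph = map (λ g → g , label g) S

  data Covered (c : V G) : Set where
    twin    : c ∈ S → ∀ {p} → p ∈ S → Adj G p c → label p ≡ label c → Covered c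
    flanked : ∀ {p q} → p ∈ S → q ∈ S → Adj G p c → Adj G q c → label p ≢ label q → Covered c

  ∈-graph : ∀ {g} → g ∈ S → (g , label g) ∈ graph
  ∈-graph = ∈-map⁺ _

  covered⇒dominating : (∀ c → Covered c) → Dominating (G ×ᵍ K m) graph
  covered⇒dominating covered (c , x) with covered c
  ... | twin c∈S {p} p∈S p~c same with label c Fin.≟ x
  ...   | yes refl = inj₁ (∈-graph c∈S)
  ...   | no c≢x   = inj₂ ((p , label p) , ∈-graph p∈S , p~c , c≢x ∘ trans (sym same))
  covered⇒dominating covered (c , x) | flanked {p} {q} p∈S q∈S p~c q~c p≢q
    with label p Fin.≟ x
  ...   | yes refl = inj₂ ((q , label q) , ∈-graph q∈S , q~c , p≢q ∘ sym)
  ...   | no p≢x   = inj₂ ((p , label p) , ∈-graph p∈S , p~c , p≢x)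

  graph-unique : Unique S → Unique graph
  graph-unique = Unique.map⁺ (cong proj₁)

module LowerBound {n : ℕ} (2≤n : 2 ≤ n) where

  private instance
    n≢0 : NonZero n
    n≢0 = >-nonZero (≤-trans (s≤s z≤n) 2≤n)

  open Cycle

  inColumn? : ∀ j → Decidable (λ (g : Fin n) → toℕ g ≡ j % n)
  inColumn? j g = toℕ g ≟ j % n

  module _ {m : ℕ} (D : List (Fin n × Fin m)) where

    columnCount : ℕ → ℕ
    columnCount j = count (inColumn? j ∘ proj₁) D

    columnCount-periodic : ∀ j → columnCount (j + n) ≡ columnCount j
    columnCount-periodic j = cong (λ r → count (λ v → toℕ (proj₁ v) ≟ r) D) ([m+n]%n≡m%n j n)

  ∑-columnCount : ∀ {m} (D : List (Fin n × Fin m)) → ∑< n (columnCount D) ≡ length D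
  ∑-columnCount []      = ∑-zero n
  ∑-columnCount (v ∷ D) =
    trans (∑-bump n (toℕ<n (proj₁ v)) elsewhere at-v) (cong suc (∑-columnCount D))
    where
    at-v : columnCount (v ∷ D) (toℕ (proj₁ v)) ≡ suc (columnCount D (toℕ (proj₁ v)))
    at-v = count-accept _ D (sym (m<n⇒m%n≡m (toℕ<n (proj₁ v))))
    elsewhere : ∀ {j} → j < n → j ≢ toℕ (proj₁ v) → columnCount (v ∷ D) j ≡ columnCount D j
    elsewhere j<n j≢v = count-reject _ D (λ v≡j → j≢v (sym (trans v≡j (m<n⇒m%n≡m j<n))))

  window : ∀ {m} → 2 ≤ m → ∀ {D} → Dominating (C n ×ᵍ K m) D → ∀ j →
           2 ≤ columnCount D j + (columnCount D (suc j) + columnCount D (suc (suc j)))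
  window 2≤m {D} dom j = begin
    2                                         ≤⟨ two-dominators (loopless 2≤n) 2≤m dom inWindow? centre near ⟩
    count (inWindow? ∘ proj₁) D               ≤⟨ count-⊎ _ _ D ⟩
    a j + count (inRight? ∘ proj₁) D          ≤⟨ +-monoʳ-≤ (a j) (count-⊎ _ _ D) ⟩
    a j + (a (suc j) + a (suc (suc j)))       ∎
    where
    open ≤-Reasoning
    a = columnCount D
    inRight? = λ g → inColumn? (suc j) g ⊎-dec inColumn? (suc (suc j)) g
    inWindow? = λ g → inColumn? j g ⊎-dec inRight? g
    centre : toℕ (suc j mod n) ≡ j % n
           ⊎ (toℕ (suc j mod n) ≡ suc j % n ⊎ toℕ (suc j mod n) ≡ suc (suc j) % n)
    centre = inj₂ (inj₁ (toℕ-fromℕ< _))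
    near : ∀ {g} → CycleAdj n g (suc j mod n) →
           toℕ g ≡ j % n ⊎ (toℕ g ≡ suc j % n ⊎ toℕ g ≡ suc (suc j) % n)
    near adj with neighbours-of-successor j adj
    ... | inj₁ e = inj₁ e
    ... | inj₂ e = inj₂ (inj₂ e)

  lower-bound : ∀ {m} → 2 ≤ m → ∀ D → Dominating (C n ×ᵍ K m) D → n * 2 ≤ 3 * length D
  lower-bound 2≤m D dom = begin
    n * 2                                               ≤⟨ N*c≤∑ n _ (window 2≤m dom) ⟩
    ∑[ j < n ] (a j + (a (suc j) + a (suc (suc j))))   ≡⟨ ∑-+ n a _ ⟩
    ∑< n a + ∑[ j < n ] (a (suc j) + a (suc (suc j)))  ≡⟨ cong (∑< n a +_) (∑-+ n (a ∘ suc) _) ⟩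
    ∑< n a + (∑< n (a ∘ suc) + ∑< n (a ∘ suc ∘ suc))   ≡⟨ cong (∑< n a +_) (cong₂ _+_ shift₁ shift₂) ⟩
    ∑< n a + (∑< n a + ∑< n a)                          ≡⟨ cong (λ x → x + (x + x)) (∑-columnCount D) ⟩
    length D + (length D + length D)                    ≡⟨ cong (λ x → length D + (length D + x)) (+-identityʳ _) ⟨
    3 * length D                                        ∎
    where
    open ≤-Reasoning
    a = columnCount D
    shift₁ : ∑< n (a ∘ suc) ≡ ∑< n a
    shift₁ = ∑-rotate n a (columnCount-periodic D 0)
    shift₂ : ∑< n (a ∘ suc ∘ suc) ≡ ∑< n a
    shift₂ = trans (∑-rotate n (a ∘ suc) (columnCount-periodic D 1)) shift₁

tabulate∘toℕ : ∀ {A : Set} N (f : ℕ → A) → tabulate {n = N} (f ∘ toℕ) ≡ applyUpTo f N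
tabulate∘toℕ zero    f = refl
tabulate∘toℕ (suc N) f = cong (f 0 ∷_) (tabulate∘toℕ N (f ∘ suc))

map-toℕ-allFin : ∀ N → map toℕ (allFin N) ≡ upTo N
map-toℕ-allFin N = trans (map-tabulate (λ i → i) toℕ) (tabulate∘toℕ N (λ j → j))

residue<2? : Decidable (λ j → j % 3 < 2)
residue<2? j = j % 3 <? 2

count-residue<2-upTo-3+ : ∀ N → count residue<2? (upTo (3 + N)) ≡ 2 + count residue<2? (upTo N)
count-residue<2-upTo-3+ N = cong (2 +_) (begin
  count residue<2? (applyUpTo (3 +_) N)   ≡⟨ cong (count residue<2?) (map-upTo (3 +_) N) ⟨
  count residue<2? (map (3 +_) (upTo N))  ≡⟨ count-map residue<2? (3 +_) (upTo N) ⟩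
  count (residue<2? ∘ (3 +_)) (upTo N)    ≡⟨ cong length (filter-≐ _ residue<2? periodic (upTo N)) ⟩
  count residue<2? (upTo N)               ∎)
  where
  open ≡-Reasoning
  [3+j]%3≡j%3 : ∀ j → (3 + j) % 3 ≡ j % 3
  [3+j]%3≡j%3 j = trans (cong (_% 3) (+-comm 3 j)) ([m+n]%n≡m%n j 3)
  periodic : (λ j → (3 + j) % 3 < 2) ≐ (λ j → j % 3 < 2)
  periodic = (λ {j} → subst (_< 2) ([3+j]%3≡j%3 j)) , (λ {j} → subst (_< 2) (sym ([3+j]%3≡j%3 j)))

count-residue<2-upTo : ∀ k {e} → e < 3 → count residue<2? (upTo (k * 3 + e)) ≡ k * 2 + e
count-residue<2-upTo zero    {0} _ = refl
count-residue<2-upTo zero    {1} _ = refl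
count-residue<2-upTo zero    {2} _ = refl
count-residue<2-upTo zero    {suc (suc (suc _))} (s≤s (s≤s (s≤s ())))
count-residue<2-upTo (suc k) e<3 =
  trans (count-residue<2-upTo-3+ (k * 3 + _)) (cong (2 +_) (count-residue<2-upTo k e<3))

-- 0, 1, 2, 1, 2, 1, … : its first k terms, read cyclically, properly colour C_k for k ≥ 2.
colour : ℕ → ℕ
colour 0 = 0
colour 1 = 1
colour 2 = 2
colour (suc (suc (suc b))) = colour (suc b)

colour<3 : ∀ b → colour b < 3
colour<3 0 = s≤s z≤n
colour<3 1 = s≤s (s≤s z≤n)
colour<3 2 = ≤-refl
colour<3 (suc (suc (suc b))) = colour<3 (suc b)

colour-suc-≢ : ∀ b → colour b ≢ colour (suc b)
colour-suc-≢ 0 ()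
colour-suc-≢ 1 ()
colour-suc-≢ 2 ()
colour-suc-≢ (suc (suc (suc b))) = colour-suc-≢ (suc b)

colour-suc-≢0 : ∀ b → colour (suc b) ≢ 0
colour-suc-≢0 0 ()
colour-suc-≢0 1 ()
colour-suc-≢0 (suc (suc b)) = colour-suc-≢0 b

colour-proper : ∀ {k} .{{_ : NonZero k}} → 2 ≤ k → ∀ i → colour (i % k) ≢ colour (suc i % k)
colour-proper {k} 2≤k i =
  subst (λ x → colour (i % k) ≢ colour x) ([1+m%d]%d≡[1+m]%d i) (proper (m%n<n i k))
  where
  proper : ∀ {b} → b < k → colour b ≢ colour (suc b % k)
  proper {b} b<k with [1+m]%d-cases b<k
  ... | inj₁ e = subst (λ x → colour b ≢ colour x) (sym e) (colour-suc-≢ b)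
  proper {zero}   _ | inj₂ (e , _) = ⊥-elim (<-irrefl e 2≤k)
  proper {suc b′} _ | inj₂ (_ , e) = subst (λ x → colour (suc b′) ≢ colour x) (sym e) (colour-suc-≢0 b′)

module Construction {m n k e : ℕ} (3≤m : 3 ≤ m) (2≤k : 2 ≤ k) (e<3 : e < 3) (n≡ : n ≡ k * 3 + e) where

  private instance
    k≢0 : NonZero k
    k≢0 = >-nonZero (≤-trans (s≤s z≤n) 2≤k)
    n≢0 : NonZero n
    n≢0 = >-nonZero (subst (0 <_) (sym n≡) (≤-trans (s≤s z≤n) (≤-trans (*-monoˡ-≤ 3 2≤k) (m≤m+n _ e))))

  open Cycle

  block : ℕ → ℕ
  block j = j / 3 % k

  label : Fin n → Fin m
  label c = fromℕ< (<-≤-trans (colour<3 (block (toℕ c))) 3≤m)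

  S : List (Fin n)
  S = filter (residue<2? ∘ toℕ) (allFin n)

  open LabelledColumns {G = C n} S label

  length-S : length S ≡ k * 2 + e
  length-S = begin
    count (residue<2? ∘ toℕ) (allFin n)    ≡⟨ count-map residue<2? toℕ (allFin n) ⟨
    count residue<2? (map toℕ (allFin n))  ≡⟨ cong (count residue<2?) (map-toℕ-allFin n) ⟩
    count residue<2? (upTo n)              ≡⟨ cong (count residue<2? ∘ upTo) n≡ ⟩
    count residue<2? (upTo (k * 3 + e))    ≡⟨ count-residue<2-upTo k e<3 ⟩
    k * 2 + e                              ∎
    where open ≡-Reasoning

  selected : ∀ {c} i {r} → r < 2 → toℕ c ≡ r + i * 3 → c ∈ S
  selected i {r} r<2 c≡ = ∈-filter⁺ (residue<2? ∘ toℕ) (∈-allFin _)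
    (subst (_< 2) (sym (trans (cong (_% 3) c≡) ([r+i*d]%d≡r i (m<n⇒m<1+n r<2)))) r<2)

  block-of : ∀ {j} i {r} → r < 3 → j ≡ r + i * 3 → block j ≡ i % k
  block-of i r<3 j≡ = cong (_% k) (trans (cong (_/ 3) j≡) ([r+i*d]/d≡i i r<3))

  block-0 : block 0 ≡ k % k
  block-0 = trans (m<n⇒m%n≡m (>-nonZero⁻¹ k)) (sym (n%n≡0 k))

  ≡n⇒quotient≡k : ∀ i {r} → r < 3 → r + i * 3 ≡ n → i ≡ k
  ≡n⇒quotient≡k i {r} r<3 eq = begin
    i                ≡⟨ [r+i*d]/d≡i i r<3 ⟨
    (r + i * 3) / 3  ≡⟨ cong (_/ 3) (trans eq (trans n≡ (+-comm (k * 3) e))) ⟩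
    (e + k * 3) / 3  ≡⟨ [r+i*d]/d≡i k e<3 ⟩
    k                ∎
    where open ≡-Reasoning

  same-label : ∀ p c → block (toℕ p) ≡ block (toℕ c) → label p ≡ label c
  same-label _ _ eq = fromℕ<-cong _ _ (cong colour eq) _ _

  different-label : ∀ p q → colour (block (toℕ p)) ≢ colour (block (toℕ q)) → label p ≢ label q
  different-label _ _ ne eq = ne (trans (sym (toℕ-fromℕ< _)) (trans (cong toℕ eq) (toℕ-fromℕ< _)))

  start-covered : ∀ {c} i → toℕ c ≡ i * 3 → Covered c
  start-covered {c} i c≡ with successor-cases c
  ... | inj₁ s≡ = twin (selected i z<s c≡) (selected i (s<s z<s) s≡′) (successor-adjacent c)
    (same-label (successor c) c (trans (block-of i (s<s z<s) s≡′) (sym (block-of i z<s c≡))))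
    where s≡′ = trans s≡ (cong suc c≡)
  ... | inj₂ (wrap , s≡0) = twin (selected i z<s c≡) (selected 0 z<s s≡0) (successor-adjacent c)
    (same-label (successor c) c (begin
      block (toℕ (successor c))  ≡⟨ cong block s≡0 ⟩
      block 0                    ≡⟨ block-0 ⟩
      k % k                      ≡⟨ cong (_% k) (≡n⇒quotient≡k i (s<s z<s) (trans (cong suc (sym c≡)) wrap)) ⟨
      i % k                      ≡⟨ block-of i z<s c≡ ⟨
      block (toℕ c)              ∎))
    where open ≡-Reasoning

  middle-covered : ∀ {c} i → toℕ c ≡ 1 + i * 3 → Covered c
  middle-covered {c} i c≡ with predecessor c≡
  ... | p , p≡ , p~c = twin (selected i (s<s z<s) c≡) (selected i z<s p≡) p~c
    (same-label p c (trans (block-of i z<s p≡) (sym (block-of i (s<s z<s) c≡))))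

  gap-covered : ∀ {c} i → toℕ c ≡ 2 + i * 3 → Covered c
  gap-covered {c} i c≡ with predecessor c≡
  ... | p , p≡ , p~c = flanked (selected i (s<s z<s) p≡) (proj₁ next) p~c (successor-adjacent c)
    (different-label p (successor c) λ eq → colour-proper 2≤k i
      (trans (cong colour (sym (block-of i (s<s z<s) p≡))) (trans eq (cong colour (proj₂ next)))))
    where
    next : successor c ∈ S × block (toℕ (successor c)) ≡ suc i % k
    next with successor-cases c
    ... | inj₁ s≡ = selected (suc i) z<s s≡′ , block-of (suc i) z<s s≡′
      where s≡′ = trans s≡ (cong suc c≡)
    ... | inj₂ (wrap , s≡0) = selected 0 z<s s≡0 , trans (cong block s≡0) (trans block-0
      (cong (_% k) (sym (≡n⇒quotient≡k (suc i) z<s (trans (cong suc (sym c≡)) wrap)))))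

  covered : ∀ c → Covered c
  covered c with toℕ c % 3 | m%n<n (toℕ c) 3 | m≡m%n+[m/n]*n (toℕ c) 3
  ... | 0 | _ | c≡ = start-covered (toℕ c / 3) c≡
  ... | 1 | _ | c≡ = middle-covered (toℕ c / 3) c≡
  ... | 2 | _ | c≡ = gap-covered (toℕ c / 3) c≡
  ... | suc (suc (suc _)) | s≤s (s≤s (s≤s ())) | _

  dominating-set : ∃[ D ] (Unique D × Dominating (C n ×ᵍ K m) D × length D ≡ k * 2 + e)
  dominating-set =
    graph , graph-unique (Unique.filter⁺ _ (Unique.allFin⁺ n)) , covered⇒dominating covered ,
    trans (length-map _ S) length-S

⌈2n/3⌉≤ : ∀ k {e} L → e < 3 → (k * 3 + e) * 2 ≤ 3 * L → k * 2 + e ≤ L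
⌈2n/3⌉≤ k {e} L e<3 2n≤3L = s≤s⁻¹ (*-cancelˡ-< 3 (k * 2 + e) (suc L) (begin-strict
  3 * (k * 2 + e)      ≡⟨ regroup k e ⟩
  (k * 3 + e) * 2 + e  <⟨ +-monoʳ-< _ e<3 ⟩
  (k * 3 + e) * 2 + 3  ≤⟨ +-monoˡ-≤ 3 2n≤3L ⟩
  3 * L + 3            ≡⟨ +-comm (3 * L) 3 ⟩
  3 + 3 * L            ≡⟨ *-suc 3 L ⟨
  3 * suc L            ∎))
  where
  open ≤-Reasoning
  regroup : ∀ k e → 3 * (k * 2 + e) ≡ (k * 3 + e) * 2 + e
  regroup = solve-∀

2≤quotient : ∀ k {e} → e < 3 → 6 ≤ k * 3 + e → 2 ≤ k
2≤quotient k {e} e<3 6≤n = s≤s⁻¹ (*-cancelʳ-< 3 2 (suc k) (begin-strict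
  2 * 3      ≤⟨ 6≤n ⟩
  k * 3 + e  <⟨ +-monoʳ-< (k * 3) e<3 ⟩
  k * 3 + 3  ≡⟨ +-comm (k * 3) 3 ⟩
  suc k * 3  ∎))
  where open ≤-Reasoning

γ[Cₙ×Kₘ] : ∀ {m n} k {e} → 3 ≤ m → 6 ≤ n → e < 3 → n ≡ 3 * k + e →
           DominationNumber (C n ×ᵍ K m) (2 * k + e)
γ[Cₙ×Kₘ] {m} {n} k {e} 3≤m 6≤n e<3 n≡3k+e =
  subst (DominationNumber (C n ×ᵍ K m)) (cong (_+ e) (*-comm k 2))
    (Construction.dominating-set 3≤m 2≤k e<3 n≡ , minimal)
  where
  n≡ : n ≡ k * 3 + e
  n≡ = trans n≡3k+e (cong (_+ e) (*-comm 3 k))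
  2≤k : 2 ≤ k
  2≤k = 2≤quotient k e<3 (subst (6 ≤_) n≡ 6≤n)
  minimal : ∀ D → Dominating (C n ×ᵍ K m) D → k * 2 + e ≤ length D
  minimal D dom = ⌈2n/3⌉≤ k (length D) e<3 (subst (λ x → x * 2 ≤ 3 * length D) n≡
    (LowerBound.lower-bound (≤-trans (s≤s (s≤s z≤n)) 6≤n) (≤-trans (s≤s (s≤s z≤n)) 3≤m) D dom))

-- The hypothesis 1 ≤ k is implied by 6 ≤ n.
theorem4p2 : ∀ (m n k : ℕ) → 3 ≤ m → 6 ≤ n → 1 ≤ k →
    ((n ≡ 3 * k → DominationNumber (C n ×ᵍ K m) (2 * k))
     × (n ≡ 3 * k + 1 → DominationNumber (C n ×ᵍ K m) (2 * k + 1))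
     × (n ≡ 3 * k + 2 → DominationNumber (C n ×ᵍ K m) (2 * k + 2)))
theorem4p2 m n k 3≤m 6≤n _ =
    (λ n≡3k → subst (DominationNumber (C n ×ᵍ K m)) (+-identityʳ (2 * k))
                (γ[Cₙ×Kₘ] k 3≤m 6≤n z<s (trans n≡3k (sym (+-identityʳ (3 * k))))))
  , γ[Cₙ×Kₘ] k 3≤m 6≤n (s<s z<s)
  , γ[Cₙ×Kₘ] k 3≤m 6≤n (s<s (s<s z<s))
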